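{- Let $m,n\ge1$, let $G=G_{m\times n}$, let $d=\gcd(m+1,n+1)$ and let $u=(a,b)$ be a vertex of $G$ with $d\mid a$ or $d\mid b$. Then $(G,u)$ is an N-position in the Undirected Edge Geography game.
   Context: $G_{m\times n}=P_m\square P_n$ is the grid graph with vertex set $[m]\times[n]$, $(i,j)\sim(i',j')$ iff $|i-i'|+|j-j'|=1$. Undirected Edge Geography is a two-player game on a rooted graph: a position is $(H,v)$ with $v$ the root; a move chooses an edge of $H$ incident to $v$, deletes it, and makes its other endpoint the new root; players alternate and the first player unable to move loses. A position is an N-position if the player to move has a winning strategy, and a P-position otherwise. -}

module Defs where

open import Data.Nat using (ℕ; _≤_; _≡ᵇ_; _≤ᵇ_; _+_)
open import Data.Nat.Base using (∣_-_∣)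
open import Data.Bool using (Bool; true; false; _∧_; _∨_; not)
open import Data.Product using (_×_; _,_)
open import Relation.Binary.PropositionalEquality using (_≡_)

-- Vertices are pairs of naturals; a (simple, undirected) graph on them is
-- given by a Boolean adjacency function (intended symmetric, irreflexive).
Vertex : Set
Vertex = ℕ × ℕ

Graph : Set
Graph = Vertex → Vertex → Bool

_==ᵛ_ : Vertex → Vertex → Bool
(i , j) ==ᵛ (i' , j') = (i ≡ᵇ i') ∧ (j ≡ᵇ j')

deleteEdge : Graph → Vertex → Vertex → Graph
deleteEdge H u w x y =
  H x y ∧ not (((x ==ᵛ u) ∧ (y ==ᵛ w)) ∨ ((x ==ᵛ w) ∧ (y ==ᵛ u)))

-- Grid graph G_{m×n} = P_m □ P_n on [m]×[n] (1-indexed):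
-- (i,j) ~ (i',j') iff both are in [m]×[n] and |i-i'|+|j-j'| = 1.
inRange : ℕ → ℕ → Vertex → Bool
inRange m n (i , j) = (1 ≤ᵇ i) ∧ (i ≤ᵇ m) ∧ (1 ≤ᵇ j) ∧ (j ≤ᵇ n)

grid : ℕ → ℕ → Graph
grid m n u@(i , j) w@(i' , j') =
  inRange m n u ∧ inRange m n w ∧ ((∣ i - i' ∣ + ∣ j - j' ∣) ≡ᵇ 1)

-- Undirected Edge Geography on a position (H , v) (v the root).
-- NPos H v : the player to move has a winning strategy (N-position).
-- PPos H v : every move leads to an N-position for the opponent (P-position);
--            in particular a position with no available move is a P-position.
data NPos (H : Graph) (v : Vertex) : Set
data PPos (H : Graph) (v : Vertex) : Set

data NPos H v where
  move : (w : Vertex) → H v w ≡ true → PPos (deleteEdge H v w) w → NPos H v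

data PPos H v where
  allMoves : ((w : Vertex) → H v w ≡ true → NPos (deleteEdge H v w) w) → PPos H v

{-# OPTIONS --safe #-}
-- The first player wins from u as soon as there is a set F of vertices such that, among the
-- vertices coloured like u, exactly u has an odd number of neighbours in F. Moving into F
-- leaves every vertex of the mover's colour with an even number of F-edges; whatever edge the
-- opponent then takes out of F makes exactly the new root odd again, so the first player always
-- has a move and, the game being finite, wins.
--
-- On the grid such an F is a sum mod 2 of points. Reflect the coordinates at 0 and m+1
-- (respectively n+1); the neighbour parity of one reflected point is the sum of its four
-- neighbours, a "plus". Summing the pluses over the diagonal parallelogram spanned from u by
-- the directions (1,1) and (1,-1) telescopes to its four corners, and the three corners other
-- than u are reflected off the grid as soon as m+1 ∣ a+p and n+1 ∣ p; Bézout provides such a p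
-- when gcd(m+1,n+1) ∣ a. Transposing the grid handles gcd(m+1,n+1) ∣ b.
module Submission where

open import Defs
open import Algebra.Bundles using (CommutativeMonoid; CommutativeRing)
open import Data.Bool using (Bool; true; false; _∧_; _∨_; not; _xor_; if_then_else_)
open import Data.Bool.Properties
  using (T-≡; T-∧; ∧-zeroʳ; ∧-identityʳ; ∧-assoc; ∧-comm; ∧-conicalˡ; ∧-conicalʳ; ∨-comm; ∨-identityʳ;
         not-involutive; not-¬; xor-assoc; xor-comm; xor-same; xor-identityʳ; xor-annihilates-not;
         not-distribˡ-xor; ∧-distribˡ-xor; ∧-distribʳ-xor; ∧-commutativeMonoid; xor-∧-commutativeRing)
open import Data.List using (List; []; _∷_; upTo; cartesianProduct)
open import Data.List.Membership.Propositional using (_∈_)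
open import Data.List.Membership.Propositional.Properties using (∈-upTo⁺; ∈-cartesianProduct⁺)
open import Data.List.Relation.Unary.All as All using ([]; _∷_)
open import Data.List.Relation.Unary.AllPairs using ([]; _∷_)
open import Data.List.Relation.Unary.Any using (here; there)
open import Data.List.Relation.Unary.Unique.Propositional using (Unique)
open import Data.Nat using (ℕ; zero; suc; pred; _≤_; _<_; _+_; _*_; _∸_; _≡ᵇ_; _≤ᵇ_; z≤n; s≤s)
open import Data.Nat.Base using (∣_-_∣)
open import Data.Nat.Divisibility using (_∣_; divides)
open import Data.Nat.GCD using (gcd; gcd-GCD; gcd-comm; module Bézout)
open import Data.Nat.Properties
  using (_≟_; ≡ᵇ⇒≡; ≡⇒≡ᵇ; ≤ᵇ⇒≤; ≤⇒≤ᵇ; ≤-refl; ≤-pred; <⇒≤; <⇒≢; <-trans; <-≤-trans; ≤∧≢⇒<;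
         m≤n⇒m≤1+n; m<n⇒m<1+n; +-mono-≤; +-mono-≤-<; +-comm; +-suc; +-identityʳ; +-∸-assoc;
         n∸n≡0; ∸-monoʳ-<; *-assoc; *-distribˡ-+; 1+n≢n; suc-injective; ∣n-n∣≡0; ∣m-n∣≡0⇒m≡n;
         ∣-∣-comm)
open import Data.Nat.Tactic.RingSolver using (solve-∀)
open import Data.Product using (_×_; _,_; proj₁; proj₂; ∃-syntax; swap)
open import Data.Product.Properties using (≡-dec)
open import Data.Sum using (_⊎_; inj₁; inj₂)
import Data.Sum as Sum
open import Function using (_∘_; Equivalence)
open import Relation.Binary.PropositionalEquality
open import Relation.Nullary using (contradiction; yes; no)

open import Algebra.Properties.CommutativeSemigroup
  (CommutativeRing.+-commutativeSemigroup xor-∧-commutativeRing) using (interchange; x∙yz≈y∙xz)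
open import Algebra.Properties.CommutativeSemigroup
  (CommutativeMonoid.commutativeSemigroup ∧-commutativeMonoid) as And using ()

≡ᵇ-refl : ∀ n → (n ≡ᵇ n) ≡ true
≡ᵇ-refl n = Equivalence.to T-≡ (≡⇒≡ᵇ n n refl)

≡ᵇ-true⇒≡ : ∀ {i k} → (i ≡ᵇ k) ≡ true → i ≡ k
≡ᵇ-true⇒≡ {i} {k} e = ≡ᵇ⇒≡ i k (Equivalence.from T-≡ e)

≡ᵇ-false⇒≢ : ∀ {i k} → (i ≡ᵇ k) ≡ false → i ≢ k
≡ᵇ-false⇒≢ {i} e refl with () ← trans (sym (≡ᵇ-refl i)) e

≢⇒≡ᵇ-false : ∀ {i k} → i ≢ k → (i ≡ᵇ k) ≡ false
≢⇒≡ᵇ-false {i} {k} i≢k with i ≡ᵇ k in e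
... | true  = contradiction (≡ᵇ-true⇒≡ e) i≢k
... | false = refl

==ᵛ⇒≡ : ∀ {v w} → (v ==ᵛ w) ≡ true → v ≡ w
==ᵛ⇒≡ {i , j} e = cong₂ _,_ (≡ᵇ-true⇒≡ (∧-conicalˡ _ _ e)) (≡ᵇ-true⇒≡ (∧-conicalʳ (i ≡ᵇ _) _ e))

==ᵛ-refl : ∀ v → (v ==ᵛ v) ≡ true
==ᵛ-refl (i , j) = cong₂ _∧_ (≡ᵇ-refl i) (≡ᵇ-refl j)

≢⇒==ᵛ-false : ∀ {v w} → v ≢ w → (v ==ᵛ w) ≡ false
≢⇒==ᵛ-false {v} {w} v≢w with v ==ᵛ w in e
... | true  = contradiction (==ᵛ⇒≡ e) v≢w
... | false = refl

xorSum : {A : Set} → List A → (A → Bool) → Bool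
xorSum []       g = false
xorSum (x ∷ xs) g = g x xor xorSum xs g

module _ {A : Set} where

  xorSum-cong : ∀ xs {g h : A → Bool} → (∀ {y} → y ∈ xs → g y ≡ h y) → xorSum xs g ≡ xorSum xs h
  xorSum-cong []       _   = refl
  xorSum-cong (x ∷ xs) g≗h = cong₂ _xor_ (g≗h (here refl)) (xorSum-cong xs (g≗h ∘ there))

  xorSum-xor : ∀ xs (g h : A → Bool) → xorSum xs (λ y → g y xor h y) ≡ xorSum xs g xor xorSum xs h
  xorSum-xor []       g h = refl
  xorSum-xor (x ∷ xs) g h = begin
    (g x xor h x) xor xorSum xs (λ y → g y xor h y)  ≡⟨ cong ((g x xor h x) xor_) (xorSum-xor xs g h) ⟩
    (g x xor h x) xor (xorSum xs g xor xorSum xs h)  ≡⟨ interchange (g x) (h x) _ _ ⟩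
    (g x xor xorSum xs g) xor (h x xor xorSum xs h)  ∎
    where open ≡-Reasoning

  xorSum≡true⇒∃ : ∀ xs {g : A → Bool} → xorSum xs g ≡ true → ∃[ y ] y ∈ xs × g y ≡ true
  xorSum≡true⇒∃ (x ∷ xs) {g} e with g x in gx
  ... | true  = x , here refl , gx
  ... | false with y , y∈xs , gy ← xorSum≡true⇒∃ xs e = y , there y∈xs , gy

xorSum-remove : ∀ {xs w} (g : Vertex → Bool) → Unique xs → w ∈ xs →
                xorSum xs (λ y → g y ∧ not (y ==ᵛ w)) ≡ g w xor xorSum xs g
xorSum-remove {x ∷ xs} {w} g (w∉xs ∷ _) (here refl) = begin
  g w ∧ not (w ==ᵛ w) xor xorSum xs (λ y → g y ∧ not (y ==ᵛ w))  ≡⟨ cong₂ _xor_ removed rest ⟩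
  xorSum xs g                                                     ≡⟨ cong (_xor xorSum xs g) (xor-same (g w)) ⟨
  (g w xor g w) xor xorSum xs g                                   ≡⟨ xor-assoc (g w) (g w) _ ⟩
  g w xor (g w xor xorSum xs g)                                   ∎
  where
  open ≡-Reasoning
  removed : g w ∧ not (w ==ᵛ w) ≡ false
  removed = trans (cong (λ b → g w ∧ not b) (==ᵛ-refl w)) (∧-zeroʳ (g w))
  rest : xorSum xs (λ y → g y ∧ not (y ==ᵛ w)) ≡ xorSum xs g
  rest = xorSum-cong xs λ y∈xs →
    trans (cong (λ b → g _ ∧ not b) (≢⇒==ᵛ-false (≢-sym (All.lookup w∉xs y∈xs)))) (∧-identityʳ _)
xorSum-remove {x ∷ xs} {w} g (x∉xs ∷ u) (there w∈xs) = begin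
  g x ∧ not (x ==ᵛ w) xor xorSum xs (λ y → g y ∧ not (y ==ᵛ w))  ≡⟨ cong₂ _xor_ kept (xorSum-remove g u w∈xs) ⟩
  g x xor (g w xor xorSum xs g)                                   ≡⟨ x∙yz≈y∙xz (g x) (g w) _ ⟩
  g w xor (g x xor xorSum xs g)                                   ∎
  where
  open ≡-Reasoning
  kept : g x ∧ not (x ==ᵛ w) ≡ g x
  kept = trans (cong (λ b → g x ∧ not b) (≢⇒==ᵛ-false (All.lookup x∉xs w∈xs))) (∧-identityʳ (g x))

-- Edge deletion and the parity strategy

_⊆ᴳ_ : Graph → Graph → Set
H' ⊆ᴳ H = ∀ {x y} → H' x y ≡ true → H x y ≡ true

Undirected : Graph → Set
Undirected H = ∀ x y → H x y ≡ H y x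

deleteEdge-⊆ : ∀ H v w → deleteEdge H v w ⊆ᴳ H
deleteEdge-⊆ H v w = ∧-conicalˡ _ _

deleteEdge-comm : ∀ H v w x y → deleteEdge H v w x y ≡ deleteEdge H w v x y
deleteEdge-comm H v w x y = cong (λ b → H x y ∧ not b) (∨-comm ((x ==ᵛ v) ∧ (y ==ᵛ w)) _)

deleteEdge-undirected : ∀ H v w → Undirected H → Undirected (deleteEdge H v w)
deleteEdge-undirected H v w H-undirected x y = cong₂ (λ a b → a ∧ not b) (H-undirected x y)
  (trans (cong₂ _∨_ (∧-comm (x ==ᵛ v) _) (∧-comm (x ==ᵛ w) _)) (∨-comm ((y ==ᵛ w) ∧ (x ==ᵛ v)) _))

deleteEdge-at : ∀ H {v w} → v ≢ w → ∀ y → deleteEdge H v w v y ≡ H v y ∧ not (y ==ᵛ w)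
deleteEdge-at H {v} {w} v≢w y
  rewrite ==ᵛ-refl v | ≢⇒==ᵛ-false v≢w | ∨-identityʳ (y ==ᵛ w) = refl

deleteEdge-away : ∀ H {v w x} → x ≢ v → x ≢ w → ∀ y → deleteEdge H v w x y ≡ H x y
deleteEdge-away H {x = x} x≢v x≢w y
  rewrite ≢⇒==ᵛ-false x≢v | ≢⇒==ᵛ-false x≢w = ∧-identityʳ (H x y)

deleteEdge-removes : ∀ H v w → deleteEdge H v w v w ≡ false
deleteEdge-removes H v w rewrite ==ᵛ-refl v | ==ᵛ-refl w = ∧-zeroʳ (H v w)

edgeCount : List (Vertex × Vertex) → Graph → ℕ
edgeCount []            H = 0
edgeCount ((x , y) ∷ E) H = (if H x y then 1 else 0) + edgeCount E H

module _ {H' H : Graph} (H'⊆H : H' ⊆ᴳ H) where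

  private
    edge-≤ : ∀ x y → (if H' x y then 1 else 0) ≤ (if H x y then 1 else 0)
    edge-≤ x y with H' x y in e
    ... | false = z≤n
    ... | true rewrite H'⊆H e = ≤-refl

  edgeCount-mono : ∀ E → edgeCount E H' ≤ edgeCount E H
  edgeCount-mono []            = z≤n
  edgeCount-mono ((x , y) ∷ E) = +-mono-≤ (edge-≤ x y) (edgeCount-mono E)

  edgeCount-< : ∀ {E v w} → (v , w) ∈ E → H' v w ≡ false → H v w ≡ true →
                edgeCount E H' < edgeCount E H
  edgeCount-< {_ ∷ E} (here refl) H'vw Hvw rewrite H'vw | Hvw = s≤s (edgeCount-mono E)
  edgeCount-< {(x , y) ∷ _} (there vw∈E) H'vw Hvw =
    +-mono-≤-< (edge-≤ x y) (edgeCount-< vw∈E H'vw Hvw)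

-- E lists the ordered edges of G and serves only to bound the length of a play; N x lists,
-- without repetition, candidates containing all neighbours of x.
module ParityStrategy
  (G : Graph) (colour : Vertex → Bool)
  (proper : ∀ x y → G x y ≡ true → colour y ≡ not (colour x))
  (E : List (Vertex × Vertex)) (E-complete : ∀ x y → G x y ≡ true → (x , y) ∈ E)
  (N : Vertex → List Vertex) (N-complete : ∀ x y → G x y ≡ true → y ∈ N x)
  (N-unique : ∀ x y → G x y ≡ true → Unique (N x))
  (F : Vertex → Bool)
  where

  oddDegree : Graph → Vertex → Bool
  oddDegree H v = xorSum (N v) (λ y → H v y ∧ F y)

  OddExactlyAt : Graph → Vertex → Set
  OddExactlyAt H v = ∀ v' → colour v' ≡ colour v → oddDegree H v' ≡ (v' ==ᵛ v)

  EvenOn : Graph → Bool → Set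
  EvenOn H side = ∀ v' → colour v' ≡ side → oddDegree H v' ≡ false

  private
    colours-differ : ∀ {v w side} → colour v ≡ side → colour w ≡ not side → v ≢ w
    colours-differ cv cw refl = not-¬ refl (trans (sym cv) cw)

  oddDegree-cong : ∀ H₁ H₂ {v} → (∀ y → H₁ v y ≡ H₂ v y) → oddDegree H₁ v ≡ oddDegree H₂ v
  oddDegree-cong H₁ H₂ {v} H₁≗H₂ = xorSum-cong (N v) λ {y} _ → cong (_∧ F y) (H₁≗H₂ y)

  oddDegree-flip : ∀ H' H {v w} → G v w ≡ true → (∀ y → H' v y ≡ H v y ∧ not (y ==ᵛ w)) →
                   oddDegree H' v ≡ (H v w ∧ F w) xor oddDegree H v
  oddDegree-flip H' H {v} {w} Gvw H'-at-v = begin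
    oddDegree H' v                                       ≡⟨ xorSum-cong (N v) (λ {y} _ → reorder y) ⟩
    xorSum (N v) (λ y → (H v y ∧ F y) ∧ not (y ==ᵛ w))  ≡⟨ xorSum-remove _ (N-unique v w Gvw) (N-complete v w Gvw) ⟩
    (H v w ∧ F w) xor oddDegree H v                      ∎
    where
    open ≡-Reasoning
    reorder : ∀ y → H' v y ∧ F y ≡ (H v y ∧ F y) ∧ not (y ==ᵛ w)
    reorder y = trans (cong (_∧ F y) (H'-at-v y)) (And.xy∙z≈xz∙y (H v y) _ (F y))

  private
    mutual
      odd⇒NPos-bounded : ∀ k {H v} → edgeCount E H < k → H ⊆ᴳ G → Undirected H → OddExactlyAt H v →
                         NPos H v
      odd⇒NPos-bounded (suc k) {H} {v} count<k H⊆G H-undirected odd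
        with w , _ , HvwFw ← xorSum≡true⇒∃ (N v) (trans (odd v refl) (==ᵛ-refl v)) =
        move w Hvw (even⇒PPos-bounded k count'<k (λ e → H⊆G (deleteEdge-⊆ H v w e))
                                        (deleteEdge-undirected H v w H-undirected) Fw even)
        where
        Hvw = ∧-conicalˡ _ _ HvwFw
        Fw = ∧-conicalʳ _ _ HvwFw
        Gvw = H⊆G Hvw
        cw : colour w ≡ not (colour v)
        cw = proper v w Gvw
        v≢w = colours-differ refl cw
        H' = deleteEdge H v w
        count'<k : edgeCount E H' < k
        count'<k = <-≤-trans (edgeCount-< (deleteEdge-⊆ H v w) (E-complete v w Gvw) (deleteEdge-removes H v w) Hvw)
                             (≤-pred count<k)
        even : EvenOn H' (not (colour w))
        even v' cv' with ≡-dec _≟_ _≟_ v' v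
        ... | yes refl = begin
          oddDegree H' v                  ≡⟨ oddDegree-flip H' H Gvw (deleteEdge-at H v≢w) ⟩
          (H v w ∧ F w) xor oddDegree H v ≡⟨ cong₂ _xor_ HvwFw (trans (odd v refl) (==ᵛ-refl v)) ⟩
          false                           ∎
          where open ≡-Reasoning
        ... | no v'≢v = begin
          oddDegree H' v'  ≡⟨ oddDegree-cong H' H (deleteEdge-away H v'≢v (colours-differ cv'v cw)) ⟩
          oddDegree H v'   ≡⟨ odd v' cv'v ⟩
          (v' ==ᵛ v)       ≡⟨ ≢⇒==ᵛ-false v'≢v ⟩
          false            ∎
          where
          open ≡-Reasoning
          cv'v = trans cv' (trans (cong not cw) (not-involutive _))

      even⇒PPos-bounded : ∀ k {H w} → edgeCount E H < k → H ⊆ᴳ G → Undirected H → F w ≡ true →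
                          EvenOn H (not (colour w)) → PPos H w
      even⇒PPos-bounded k {H} {w} count<k H⊆G H-undirected Fw even = allMoves respond
        where
        respond : ∀ v → H w v ≡ true → NPos (deleteEdge H w v) v
        respond v Hwv = odd⇒NPos-bounded k count''<k (λ e → H⊆G (deleteEdge-⊆ H w v e))
                                          (deleteEdge-undirected H w v H-undirected) odd
          where
          Hvw = trans (H-undirected v w) Hwv
          Gvw = H⊆G Hvw
          cv : colour v ≡ not (colour w)
          cv = proper w v (H⊆G Hwv)
          v≢w = colours-differ cv (sym (not-involutive _))
          H'' = deleteEdge H w v
          count''<k : edgeCount E H'' < k
          count''<k = <-trans (edgeCount-< (deleteEdge-⊆ H w v) (E-complete w v (H⊆G Hwv))
                                           (deleteEdge-removes H w v) Hwv)
                              count<k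
          odd : OddExactlyAt H'' v
          odd v' cv' with ≡-dec _≟_ _≟_ v' v
          ... | yes refl = begin
            oddDegree H'' v                 ≡⟨ oddDegree-flip H'' H Gvw
                                                 (λ y → trans (deleteEdge-comm H w v v y) (deleteEdge-at H v≢w y)) ⟩
            (H v w ∧ F w) xor oddDegree H v ≡⟨ cong₂ _xor_ (cong₂ _∧_ Hvw Fw) (even v cv) ⟩
            true                            ≡⟨ ==ᵛ-refl v ⟨
            (v ==ᵛ v)                       ∎
            where open ≡-Reasoning
          ... | no v'≢v = begin
            oddDegree H'' v'  ≡⟨ oddDegree-cong H'' H
                                   (deleteEdge-away H (colours-differ (trans cv' cv) (sym (not-involutive _))) v'≢v) ⟩
            oddDegree H v'    ≡⟨ even v' (trans cv' cv) ⟩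
            false             ≡⟨ ≢⇒==ᵛ-false v'≢v ⟨
            (v' ==ᵛ v)        ∎
            where open ≡-Reasoning

  odd⇒NPos : Undirected G → ∀ u → OddExactlyAt G u → NPos G u
  odd⇒NPos G-undirected u odd = odd⇒NPos-bounded (suc (edgeCount E G)) ≤-refl (λ e → e) G-undirected odd

==ᵛ-swap : ∀ x v → (x ==ᵛ swap v) ≡ (swap x ==ᵛ v)
==ᵛ-swap (i , j) (k , l) = ∧-comm (i ≡ᵇ l) (j ≡ᵇ k)

Transposed : Graph → Graph → Set
Transposed H' H = ∀ x y → H' x y ≡ H (swap x) (swap y)

deleteEdge-transposed : ∀ {H' H} → Transposed H' H → ∀ v w →
                        Transposed (deleteEdge H' (swap v) (swap w)) (deleteEdge H v w)
deleteEdge-transposed t v w x y = cong₂ (λ a b → a ∧ not b) (t x y)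
  (cong₂ _∨_ (cong₂ _∧_ (==ᵛ-swap x v) (==ᵛ-swap y w)) (cong₂ _∧_ (==ᵛ-swap x w) (==ᵛ-swap y v)))

mutual
  NPos-transpose : ∀ {H' H v} → Transposed H' H → NPos H v → NPos H' (swap v)
  NPos-transpose {v = v} t (move w Hvw p) =
    move (swap w) (trans (t (swap v) (swap w)) Hvw) (PPos-transpose (deleteEdge-transposed t v w) p)

  PPos-transpose : ∀ {H' H v} → Transposed H' H → PPos H v → PPos H' (swap v)
  PPos-transpose {v = v} t (allMoves respond) = allMoves λ w H'vw →
    NPos-transpose (deleteEdge-transposed t v (swap w)) (respond (swap w) (trans (sym (t (swap v) w)) H'vw))

grid-transposed : ∀ m n → Transposed (grid m n) (grid n m)
grid-transposed m n (i , j) (k , l) = trans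
  (cong₂ (λ a b → a ∧ b ∧ (∣ i - k ∣ + ∣ j - l ∣ ≡ᵇ 1)) (inRange-swap i j) (inRange-swap k l))
  (cong (λ d → inRange n m (j , i) ∧ inRange n m (l , k) ∧ (d ≡ᵇ 1)) (+-comm ∣ i - k ∣ ∣ j - l ∣))
  where
  inRange-swap : ∀ i j → inRange m n (i , j) ≡ inRange n m (j , i)
  inRange-swap i j = trans (sym (∧-assoc (1 ≤ᵇ i) (i ≤ᵇ m) _))
                           (trans (∧-comm ((1 ≤ᵇ i) ∧ (i ≤ᵇ m)) _) (∧-assoc (1 ≤ᵇ j) (j ≤ᵇ n) _))

-- The grid graph

parity : ℕ → Bool
parity zero    = false
parity (suc n) = not (parity n)

colour : Vertex → Bool
colour (i , j) = parity i xor parity j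

parity-+ : ∀ m n → parity (m + n) ≡ parity m xor parity n
parity-+ zero    n = refl
parity-+ (suc m) n = trans (cong not (parity-+ m n)) (not-distribˡ-xor (parity m) (parity n))

parity-∣-∣ : ∀ m n → parity ∣ m - n ∣ ≡ parity m xor parity n
parity-∣-∣ zero    n       = refl
parity-∣-∣ (suc m) zero    = sym (xor-identityʳ _)
parity-∣-∣ (suc m) (suc n) = trans (parity-∣-∣ m n) (sym (xor-annihilates-not (parity m) (parity n)))

xor≡true⇒≡not : ∀ a b → a xor b ≡ true → b ≡ not a
xor≡true⇒≡not true  b e = trans (sym (not-involutive b)) (cong not e)
xor≡true⇒≡not false b e = e

xor≡true⇒⊎ : ∀ a b → a xor b ≡ true → a ≡ true ⊎ b ≡ true
xor≡true⇒⊎ true  b _ = inj₁ refl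
xor≡true⇒⊎ false b e = inj₂ e

-- Off the grid (i = 0 or j = 0) the list is junk, since pred 0 = 0; it is only used on the grid.
neighbours : Vertex → List Vertex
neighbours (i , j) = (suc i , j) ∷ (pred i , j) ∷ (i , suc j) ∷ (i , pred j) ∷ []

xorSum-neighbours : ∀ (f : Vertex → Bool) i j → xorSum (neighbours (i , j)) f ≡
                    (f (suc i , j) xor f (pred i , j)) xor (f (i , suc j) xor f (i , pred j))
xorSum-neighbours f i j =
  trans (cong (λ t → f (suc i , j) xor (f (pred i , j) xor (f (i , suc j) xor t))) (xor-identityʳ _))
        (sym (xor-assoc (f (suc i , j)) _ _))

private
  +≡1 : ∀ a b → a + b ≡ 1 → (a ≡ 0 × b ≡ 1) ⊎ (a ≡ 1 × b ≡ 0)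
  +≡1 zero          b       e  = inj₁ (refl , e)
  +≡1 (suc zero)    zero    _  = inj₂ (refl , refl)
  +≡1 (suc zero)    (suc b) ()
  +≡1 (suc (suc a)) b       ()

  ∣-∣≡1 : ∀ i k → ∣ i - k ∣ ≡ 1 → k ≡ suc i ⊎ i ≡ suc k
  ∣-∣≡1 zero    (suc k) e = inj₁ e
  ∣-∣≡1 (suc i) zero    e = inj₂ e
  ∣-∣≡1 (suc i) (suc k) e = Sum.map (cong suc) (cong suc) (∣-∣≡1 i k e)

  ∣n-1+n∣≡1 : ∀ n → ∣ n - suc n ∣ ≡ 1
  ∣n-1+n∣≡1 zero    = refl
  ∣n-1+n∣≡1 (suc n) = ∣n-1+n∣≡1 n

  2+n≢n : ∀ {n} → suc (suc n) ≢ n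
  2+n≢n {suc n} = 2+n≢n ∘ suc-injective

distance-one⇒neighbour : ∀ {i j k l} → ∣ i - k ∣ + ∣ j - l ∣ ≡ 1 → (k , l) ∈ neighbours (i , j)
distance-one⇒neighbour {i} {j} {k} {l} e with +≡1 ∣ i - k ∣ ∣ j - l ∣ e
... | inj₁ (di , dj) with ∣m-n∣≡0⇒m≡n {i} {k} di | ∣-∣≡1 j l dj
...   | refl | inj₁ refl = there (there (here refl))
...   | refl | inj₂ refl = there (there (there (here refl)))
distance-one⇒neighbour {i} {j} {k} {l} e | inj₂ (di , dj) with ∣-∣≡1 i k di | ∣m-n∣≡0⇒m≡n {j} {l} dj
...   | inj₁ refl | refl = here refl
...   | inj₂ refl | refl = there (here refl)

neighbour⇒distance-one : ∀ {i j k l} → 1 ≤ i → 1 ≤ j → (k , l) ∈ neighbours (i , j) →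
                         ∣ i - k ∣ + ∣ j - l ∣ ≡ 1
neighbour⇒distance-one {suc i} {suc j} _ _ (here refl) = cong₂ _+_ (∣n-1+n∣≡1 i) (∣n-n∣≡0 j)
neighbour⇒distance-one {suc i} {suc j} _ _ (there (here refl)) =
  cong₂ _+_ (trans (∣-∣-comm (suc i) i) (∣n-1+n∣≡1 i)) (∣n-n∣≡0 j)
neighbour⇒distance-one {suc i} {suc j} _ _ (there (there (here refl))) = cong₂ _+_ (∣n-n∣≡0 i) (∣n-1+n∣≡1 j)
neighbour⇒distance-one {suc i} {suc j} _ _ (there (there (there (here refl)))) =
  cong₂ _+_ (∣n-n∣≡0 i) (trans (∣-∣-comm (suc j) j) (∣n-1+n∣≡1 j))

neighbours-unique : ∀ {i j} → 1 ≤ i → 1 ≤ j → Unique (neighbours (i , j))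
neighbours-unique {suc i} {suc j} _ _ =
  (2+n≢n ∘ cong proj₁ ∷ 1+n≢n ∘ cong proj₁ ∷ 1+n≢n ∘ cong proj₁ ∷ []) ∷
  (1+n≢n ∘ sym ∘ cong proj₁ ∷ 1+n≢n ∘ sym ∘ cong proj₁ ∷ []) ∷
  (2+n≢n ∘ cong proj₂ ∷ []) ∷
  [] ∷ []

module Grid (m n : ℕ) where

  InRange : Vertex → Set
  InRange v = inRange m n v ≡ true

  inRange⇒bounds : ∀ {i j} → InRange (i , j) → 1 ≤ i × i ≤ m × 1 ≤ j × j ≤ n
  inRange⇒bounds {i} {j} r with Equivalence.to T-∧ (Equivalence.from T-≡ r)
  ... | 1≤i , rest with Equivalence.to T-∧ rest
  ... | i≤m , rest′ with Equivalence.to T-∧ rest′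
  ... | 1≤j , j≤n = ≤ᵇ⇒≤ 1 i 1≤i , ≤ᵇ⇒≤ i m i≤m , ≤ᵇ⇒≤ 1 j 1≤j , ≤ᵇ⇒≤ j n j≤n

  bounds⇒inRange : ∀ {i j} → 1 ≤ i → i ≤ m → 1 ≤ j → j ≤ n → InRange (i , j)
  bounds⇒inRange 1≤i i≤m 1≤j j≤n = Equivalence.to T-≡ (Equivalence.from T-∧
    (≤⇒≤ᵇ 1≤i , Equivalence.from T-∧ (≤⇒≤ᵇ i≤m , Equivalence.from T-∧ (≤⇒≤ᵇ 1≤j , ≤⇒≤ᵇ j≤n))))

  grid-inRange : ∀ x y → grid m n x y ≡ true → InRange x × InRange y
  grid-inRange x y e = ∧-conicalˡ _ _ e , ∧-conicalˡ _ _ (∧-conicalʳ (inRange m n x) _ e)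

  grid-distance : ∀ i j k l → grid m n (i , j) (k , l) ≡ true → ∣ i - k ∣ + ∣ j - l ∣ ≡ 1
  grid-distance i j k l e =
    ≡ᵇ-true⇒≡ (∧-conicalʳ (inRange m n (k , l)) _ (∧-conicalʳ (inRange m n (i , j)) _ e))

  outside⇒isolated : ∀ {v} y → inRange m n v ≡ false → grid m n v y ≡ false
  outside⇒isolated {i , j} (k , l) rv =
    cong (λ b → b ∧ inRange m n (k , l) ∧ (∣ i - k ∣ + ∣ j - l ∣ ≡ᵇ 1)) rv

  grid-undirected : Undirected (grid m n)
  grid-undirected (i , j) (k , l) = trans (And.x∙yz≈y∙xz (inRange m n (i , j)) (inRange m n (k , l)) _)
    (cong (λ d → inRange m n (k , l) ∧ inRange m n (i , j) ∧ (d ≡ᵇ 1))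
          (cong₂ _+_ (∣-∣-comm i k) (∣-∣-comm j l)))

  grid-proper : ∀ x y → grid m n x y ≡ true → colour y ≡ not (colour x)
  grid-proper (i , j) (k , l) e = xor≡true⇒≡not (colour (i , j)) (colour (k , l)) (begin
    colour (i , j) xor colour (k , l)                    ≡⟨ interchange (parity i) (parity j) _ _ ⟩
    (parity i xor parity k) xor (parity j xor parity l)  ≡⟨ cong₂ _xor_ (parity-∣-∣ i k) (parity-∣-∣ j l) ⟨
    parity ∣ i - k ∣ xor parity ∣ j - l ∣                ≡⟨ parity-+ ∣ i - k ∣ _ ⟨
    parity (∣ i - k ∣ + ∣ j - l ∣)                       ≡⟨ cong parity (grid-distance i j k l e) ⟩
    true                                                 ∎)
    where open ≡-Reasoning

  grid⇒neighbour : ∀ x y → grid m n x y ≡ true → y ∈ neighbours x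
  grid⇒neighbour (i , j) (k , l) e = distance-one⇒neighbour (grid-distance i j k l e)

  neighbour⇒grid : ∀ {x y} → InRange x → InRange y → y ∈ neighbours x → grid m n x y ≡ true
  neighbour⇒grid {i , j} {k , l} rx ry y∈N with 1≤i , _ , 1≤j , _ ← inRange⇒bounds rx =
    trans (cong₂ (λ a b → a ∧ b ∧ (∣ i - k ∣ + ∣ j - l ∣ ≡ᵇ 1)) rx ry)
          (cong (_≡ᵇ 1) (neighbour⇒distance-one 1≤i 1≤j y∈N))

  grid⇒neighbours-unique : ∀ x y → grid m n x y ≡ true → Unique (neighbours x)
  grid⇒neighbours-unique (i , j) y e with 1≤i , _ , 1≤j , _ ← inRange⇒bounds (proj₁ (grid-inRange (i , j) y e)) =
    neighbours-unique 1≤i 1≤j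

  vertices : List Vertex
  vertices = cartesianProduct (upTo (suc m)) (upTo (suc n))

  inRange⇒∈vertices : ∀ {v} → InRange v → v ∈ vertices
  inRange⇒∈vertices {i , j} r with _ , i≤m , _ , j≤n ← inRange⇒bounds r =
    ∈-cartesianProduct⁺ (∈-upTo⁺ (s≤s i≤m)) (∈-upTo⁺ (s≤s j≤n))

  grid⇒∈vertices² : ∀ x y → grid m n x y ≡ true → (x , y) ∈ cartesianProduct vertices vertices
  grid⇒∈vertices² x y e with rx , ry ← grid-inRange x y e =
    ∈-cartesianProduct⁺ (inRange⇒∈vertices rx) (inRange⇒∈vertices ry)

-- Walks reflected at 0 and m+1

module Fold (m : ℕ) where

  Boundary : ℕ → Set
  Boundary v = v ≡ 0 ⊎ v ≡ suc m

  boundary⇒≢ : ∀ {v i} → Boundary v → 1 ≤ i → i ≤ m → (i ≡ᵇ v) ≡ false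
  boundary⇒≢ (inj₁ refl) (s≤s _) _   = refl
  boundary⇒≢ (inj₂ refl) _       i≤m = ≢⇒≡ᵇ-false (<⇒≢ (s≤s i≤m))

  -- walk x is the state after x steps of the walk 0, 1, …, m, m+1, m, …, 1, 0, 1, … together
  -- with its direction (true = upwards); fold x is its position.
  bounce : ℕ × Bool → ℕ × Bool
  bounce (v , true)  = suc v  , not (v ≡ᵇ m)
  bounce (v , false) = pred v , (v ≡ᵇ 1)

  walk : ℕ → ℕ × Bool
  walk zero    = 0 , true
  walk (suc x) = bounce (walk x)

  fold : ℕ → ℕ
  fold x = proj₁ (walk x)

  Valid : ℕ × Bool → Set
  Valid (v , true)  = v ≤ m
  Valid (v , false) = 1 ≤ v × v ≤ suc m

  bounce-valid : ∀ s → Valid s → Valid (bounce s)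
  bounce-valid (v , true) v≤m with v ≡ᵇ m in e
  ... | true  = s≤s z≤n , s≤s v≤m
  ... | false = ≤∧≢⇒< v≤m (≡ᵇ-false⇒≢ e)
  bounce-valid (suc zero , false)    _           = z≤n
  bounce-valid (suc (suc v) , false) (_ , s≤s v<m) = s≤s z≤n , m≤n⇒m≤1+n v<m

  walk-valid : ∀ x → Valid (walk x)
  walk-valid zero    = z≤n
  walk-valid (suc x) = bounce-valid (walk x) (walk-valid x)

  walk-small : ∀ x → x ≤ m → walk x ≡ (x , true)
  walk-small zero    _   = refl
  walk-small (suc x) x<m rewrite walk-small x (<⇒≤ x<m) | ≢⇒≡ᵇ-false (<⇒≢ x<m) = refl

  fold-small : ∀ x → x ≤ m → fold x ≡ x
  fold-small x x≤m = cong proj₁ (walk-small x x≤m)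

  private
    ∸≡ᵇ0 : ∀ v k → v ≤ k → ((k ∸ v) ≡ᵇ 0) ≡ (v ≡ᵇ k)
    ∸≡ᵇ0 zero    zero    _         = refl
    ∸≡ᵇ0 zero    (suc k) _         = refl
    ∸≡ᵇ0 (suc v) (suc k) (s≤s v≤k) = ∸≡ᵇ0 v k v≤k

    ∸≡ᵇm : ∀ v → v ≤ m → ((m ∸ v) ≡ᵇ m) ≡ (v ≡ᵇ 0)
    ∸≡ᵇm zero    _   = ≡ᵇ-refl m
    ∸≡ᵇm (suc v) v<m = ≢⇒≡ᵇ-false (<⇒≢ (∸-monoʳ-< (s≤s z≤n) v<m))

  mirror : ℕ × Bool → ℕ × Bool
  mirror (v , d) = suc m ∸ v , not d

  bounce-mirror : ∀ s → Valid s → bounce (mirror s) ≡ mirror (bounce s)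
  bounce-mirror (v , true) v≤m
    rewrite +-∸-assoc 1 v≤m | ∸≡ᵇ0 v m v≤m | not-involutive (v ≡ᵇ m) = refl
  bounce-mirror (suc v , false) (_ , s≤s v≤m)
    rewrite +-∸-assoc 1 v≤m | ∸≡ᵇm v v≤m = refl

  walk-shift : ∀ x → walk (x + suc m) ≡ mirror (walk x)
  walk-shift zero    rewrite walk-small m ≤-refl | ≡ᵇ-refl m = refl
  walk-shift (suc x) rewrite walk-shift x = bounce-mirror (walk x) (walk-valid x)

  walk-multiple : ∀ q → walk (q * suc m) ≡ (0 , true) ⊎ walk (q * suc m) ≡ (suc m , false)
  walk-multiple zero    = inj₁ refl
  walk-multiple (suc q) = Sum.swap (Sum.map (λ eq → trans shift (cong mirror eq))
                                            (λ eq → trans shift (trans (cong mirror eq) (cong (_, true) (n∸n≡0 m))))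
                                            (walk-multiple q))
    where
    shift : walk (suc q * suc m) ≡ mirror (walk (q * suc m))
    shift = trans (cong walk (+-comm (suc m) (q * suc m))) (walk-shift (q * suc m))

  fold-boundary : ∀ {x} → suc m ∣ x → Boundary (fold x)
  fold-boundary (divides q refl) with walk-multiple q
  ... | inj₁ eq = inj₁ (cong proj₁ eq)
  ... | inj₂ eq = inj₂ (cong proj₁ eq)

  -- Around a step at X the walk either turns at a mirror, so that it comes from and goes to the
  -- same point, or passes through an interior X, coming from and going to X ∓ 1 (said by pass
  -- through indicators).
  data Local (P X Q : ℕ) : Set where
    reflect : Boundary X → P ≡ Q → Local P X Q
    pass    : 1 ≤ X → X ≤ m → (∀ i → (i ≡ᵇ P) xor (i ≡ᵇ Q) ≡ (suc i ≡ᵇ X) xor (pred i ≡ᵇ X)) → Local P X Q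

  private
    pass-up : ∀ X i → (i ≡ᵇ X) xor (i ≡ᵇ suc (suc X)) ≡ (suc i ≡ᵇ suc X) xor (pred i ≡ᵇ suc X)
    pass-up X zero    = refl
    pass-up X (suc i) = refl

  bounce-local : ∀ s → Valid s → Local (proj₁ s) (proj₁ (bounce s)) (proj₁ (bounce (bounce s)))
  bounce-local (v , true) v≤m with v ≡ᵇ m in e
  ... | true  = reflect (inj₂ (cong suc (≡ᵇ-true⇒≡ e))) refl
  ... | false = pass (s≤s z≤n) (≤∧≢⇒< v≤m (≡ᵇ-false⇒≢ e)) (pass-up v)
  bounce-local (suc zero , false)    _               = reflect (inj₁ refl) refl
  bounce-local (suc (suc v) , false) (_ , s≤s v<m)   =
    pass (s≤s z≤n) v<m (λ i → trans (xor-comm (i ≡ᵇ suc (suc v)) _) (pass-up v i))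

  fold-local : ∀ x → Local (fold x) (fold (suc x)) (fold (suc (suc x)))
  fold-local x = bounce-local (walk x) (walk-valid x)

-- Realizable neighbour parities

module Realizability (m n : ℕ) where
  open Grid m n
  module Fm = Fold m
  module Fn = Fold n

  Realizable : (Vertex → Bool) → Set
  Realizable D = ∃[ f ] (∀ y → f y ≡ true → InRange y) × (∀ z → InRange z → xorSum (neighbours z) f ≡ D z)

  realizable-false : Realizable (λ _ → false)
  realizable-false = (λ _ → false) , (λ _ ()) , λ _ _ → refl

  realizable-cong : ∀ {D D'} → Realizable D → (∀ z → InRange z → D z ≡ D' z) → Realizable D'
  realizable-cong (f , f⊆V , odd) D≗D' = f , f⊆V , λ z r → trans (odd z r) (D≗D' z r)

  realizable-xor : ∀ {D D'} → Realizable D → Realizable D' → Realizable (λ z → D z xor D' z)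
  realizable-xor (f , f⊆V , odd) (g , g⊆V , odd') = (λ y → f y xor g y) , support ,
    λ z r → trans (xorSum-xor (neighbours z) f g) (cong₂ _xor_ (odd z r) (odd' z r))
    where
    support : ∀ y → f y xor g y ≡ true → InRange y
    support y e with xor≡true⇒⊎ (f y) (g y) e
    ... | inj₁ fy = f⊆V y fy
    ... | inj₂ gy = g⊆V y gy

  telescope : ∀ (h : ℕ → Vertex → Bool) p → (∀ i → i < p → Realizable (λ z → h i z xor h (suc i) z)) →
              Realizable (λ z → h 0 z xor h p z)
  telescope h zero    _     = realizable-cong realizable-false λ z _ → sym (xor-same (h 0 z))
  telescope h (suc p) steps =
    realizable-cong (realizable-xor (telescope h p (λ i i<p → steps i (m<n⇒m<1+n i<p))) (steps p ≤-refl))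
      λ z _ → cancel (h 0 z) (h p z) (h (suc p) z)
    where
    cancel : ∀ a b c → (a xor b) xor (b xor c) ≡ a xor c
    cancel a b c = begin
      (a xor b) xor (b xor c)  ≡⟨ xor-assoc a b (b xor c) ⟩
      a xor (b xor (b xor c))  ≡⟨ cong (a xor_) (xor-assoc b b c) ⟨
      a xor ((b xor b) xor c)  ≡⟨ cong (λ t → a xor (t xor c)) (xor-same b) ⟩
      a xor c                  ∎
      where open ≡-Reasoning

  telescope₂ : ∀ (g : ℕ → ℕ → Vertex → Bool) p q →
               (∀ i k → i < p → k < q →
                  Realizable (λ z → (g i k z xor g (suc i) k z) xor (g i (suc k) z xor g (suc i) (suc k) z))) →
               Realizable (λ z → (g 0 0 z xor g 0 q z) xor (g p 0 z xor g p q z))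
  telescope₂ g p q cells = telescope (λ i z → g i 0 z xor g i q z) p λ i i<p →
    realizable-cong (telescope (λ k z → g i k z xor g (suc i) k z) q (λ k k<q → cells i k i<p k<q))
      λ z _ → interchange (g i 0 z) (g (suc i) 0 z) (g i q z) (g (suc i) q z)

  -- The neighbour parity of the point (X₁, Y₁) is the plus of its four neighbours. At a mirror
  -- two opposite arms of the plus coincide and the other two lie off the grid.
  realizable-plus : ∀ {X₀ X₁ X₂ Y₀ Y₁ Y₂} → Fm.Local X₀ X₁ X₂ → Fn.Local Y₀ Y₁ Y₂ →
         Realizable (λ z → ((z ==ᵛ (X₀ , Y₁)) xor (z ==ᵛ (X₂ , Y₁))) xor ((z ==ᵛ (X₁ , Y₀)) xor (z ==ᵛ (X₁ , Y₂))))
  realizable-plus {X₀} {X₁} {Y₀ = Y₀} {Y₁} {Y₂} (Fm.reflect bX refl) _ = realizable-cong realizable-false vanish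
    where
    vanish : ∀ z → InRange z →
             false ≡ ((z ==ᵛ (X₀ , Y₁)) xor (z ==ᵛ (X₀ , Y₁))) xor ((z ==ᵛ (X₁ , Y₀)) xor (z ==ᵛ (X₁ , Y₂)))
    vanish (i , j) r with 1≤i , i≤m , _ ← inRange⇒bounds {i} {j} r rewrite Fm.boundary⇒≢ bX 1≤i i≤m =
      sym (trans (xor-identityʳ _) (xor-same ((i ≡ᵇ X₀) ∧ (j ≡ᵇ Y₁))))
  realizable-plus {X₀} {X₁} {X₂} {Y₀} {Y₁} (Fm.pass _ _ _) (Fn.reflect bY refl) = realizable-cong realizable-false vanish
    where
    vanish : ∀ z → InRange z →
             false ≡ ((z ==ᵛ (X₀ , Y₁)) xor (z ==ᵛ (X₂ , Y₁))) xor ((z ==ᵛ (X₁ , Y₀)) xor (z ==ᵛ (X₁ , Y₀)))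
    vanish (i , j) r with _ , _ , 1≤j , j≤n ← inRange⇒bounds {i} {j} r rewrite Fn.boundary⇒≢ bY 1≤j j≤n =
      sym (cong₂ _xor_ (cong₂ _xor_ (∧-zeroʳ (i ≡ᵇ X₀)) (∧-zeroʳ (i ≡ᵇ X₂))) (xor-same ((i ≡ᵇ X₁) ∧ (j ≡ᵇ Y₀))))
  realizable-plus {X₀} {X₁} {X₂} {Y₀} {Y₁} {Y₂} (Fm.pass 1≤X X≤m passX) (Fn.pass 1≤Y Y≤n passY) =
    (_==ᵛ (X₁ , Y₁)) , centre-inRange , odd
    where
    centre-inRange : ∀ y → (y ==ᵛ (X₁ , Y₁)) ≡ true → InRange y
    centre-inRange y e rewrite ==ᵛ⇒≡ {y} e = bounds⇒inRange 1≤X X≤m 1≤Y Y≤n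
    odd : ∀ z → InRange z → xorSum (neighbours z) (_==ᵛ (X₁ , Y₁)) ≡
          ((z ==ᵛ (X₀ , Y₁)) xor (z ==ᵛ (X₂ , Y₁))) xor ((z ==ᵛ (X₁ , Y₀)) xor (z ==ᵛ (X₁ , Y₂)))
    odd (i , j) _ = begin
      xorSum (neighbours (i , j)) (_==ᵛ (X₁ , Y₁))
        ≡⟨ xorSum-neighbours (_==ᵛ (X₁ , Y₁)) i j ⟩
      ((suc i ≡ᵇ X₁) ∧ (j ≡ᵇ Y₁) xor (pred i ≡ᵇ X₁) ∧ (j ≡ᵇ Y₁)) xor
        ((i ≡ᵇ X₁) ∧ (suc j ≡ᵇ Y₁) xor (i ≡ᵇ X₁) ∧ (pred j ≡ᵇ Y₁))
        ≡⟨ cong₂ _xor_ (∧-distribʳ-xor (j ≡ᵇ Y₁) (suc i ≡ᵇ X₁) _) (∧-distribˡ-xor (i ≡ᵇ X₁) (suc j ≡ᵇ Y₁) _) ⟨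
      ((suc i ≡ᵇ X₁) xor (pred i ≡ᵇ X₁)) ∧ (j ≡ᵇ Y₁) xor (i ≡ᵇ X₁) ∧ ((suc j ≡ᵇ Y₁) xor (pred j ≡ᵇ Y₁))
        ≡⟨ cong₂ (λ s t → s ∧ (j ≡ᵇ Y₁) xor (i ≡ᵇ X₁) ∧ t) (passX i) (passY j) ⟨
      ((i ≡ᵇ X₀) xor (i ≡ᵇ X₂)) ∧ (j ≡ᵇ Y₁) xor (i ≡ᵇ X₁) ∧ ((j ≡ᵇ Y₀) xor (j ≡ᵇ Y₂))
        ≡⟨ cong₂ _xor_ (∧-distribʳ-xor (j ≡ᵇ Y₁) (i ≡ᵇ X₀) _) (∧-distribˡ-xor (i ≡ᵇ X₁) (j ≡ᵇ Y₀) _) ⟩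
      ((i ≡ᵇ X₀) ∧ (j ≡ᵇ Y₁) xor (i ≡ᵇ X₂) ∧ (j ≡ᵇ Y₁)) xor ((i ≡ᵇ X₁) ∧ (j ≡ᵇ Y₀) xor (i ≡ᵇ X₁) ∧ (j ≡ᵇ Y₂))
        ∎
      where open ≡-Reasoning

  fold² : Vertex → Vertex
  fold² (x , y) = Fm.fold x , Fn.fold y

  vanishˣ : ∀ x y z → Fm.Boundary (Fm.fold x) → InRange z → (z ==ᵛ fold² (x , y)) ≡ false
  vanishˣ x y (i , j) b r with 1≤i , i≤m , _ ← inRange⇒bounds {i} {j} r =
    cong (_∧ (j ≡ᵇ Fn.fold y)) (Fm.boundary⇒≢ b 1≤i i≤m)

  vanishʸ : ∀ x y z → Fn.Boundary (Fn.fold y) → InRange z → (z ==ᵛ fold² (x , y)) ≡ false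
  vanishʸ x y (i , j) b r with _ , _ , 1≤j , j≤n ← inRange⇒bounds {i} {j} r =
    trans (cong ((i ≡ᵇ Fm.fold x) ∧_) (Fn.boundary⇒≢ b 1≤j j≤n)) (∧-zeroʳ _)

  private
    ∸-suc : ∀ {k b} → k < b → b ∸ k ≡ suc (b ∸ suc k)
    ∸-suc {zero}  {suc b} _         = refl
    ∸-suc {suc k} {suc b} (s≤s k<b) = ∸-suc k<b

    xor-exchange : ∀ a b c d → (a xor b) xor (c xor d) ≡ (a xor d) xor (c xor b)
    xor-exchange a b c d = begin
      (a xor b) xor (c xor d)  ≡⟨ interchange a b c d ⟩
      (a xor c) xor (b xor d)  ≡⟨ cong ((a xor c) xor_) (xor-comm b d) ⟩
      (a xor c) xor (d xor b)  ≡⟨ interchange a c d b ⟩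
      (a xor d) xor (c xor b)  ∎
      where open ≡-Reasoning

  -- The cells of the parallelogram with corners (a, b), (a+b, 0), (a+p, b+p) and (a+p+b, p) are
  -- pluses; telescoping leaves the corners, and all of them but (a, b) fold onto a mirror.
  realizable-point : ∀ {a b p} → a ≤ m → b ≤ n → suc m ∣ a + p → suc n ∣ p → Realizable (_==ᵛ (a , b))
  realizable-point {a} {b} {p} a≤m b≤n m+1∣a+p n+1∣p = realizable-cong (telescope₂ g p b cell) corners
    where
    corner : ℕ → ℕ → Vertex
    corner i k = a + i + k , (b ∸ k) + i

    g : ℕ → ℕ → Vertex → Bool
    g i k z = z ==ᵛ fold² (corner i k)

    cell : ∀ i k → i < p → k < b →
           Realizable (λ z → (g i k z xor g (suc i) k z) xor (g i (suc k) z xor g (suc i) (suc k) z))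
    cell i k _ k<b = realizable-cong (realizable-plus (Fm.fold-local x) (Fn.fold-local y)) λ z _ →
      trans (xor-exchange (z ==ᵛ fold² (x , suc y)) (z ==ᵛ fold² (suc (suc x) , suc y))
                           (z ==ᵛ fold² (suc x , y)) (z ==ᵛ fold² (suc x , suc (suc y))))
            (cong₂ _xor_ (cong₂ _xor_ (at z west) (at z north)) (cong₂ _xor_ (at z south) (at z east)))
      where
      x = a + i + k
      y = (b ∸ suc k) + i
      at : ∀ z {v w} → v ≡ w → (z ==ᵛ fold² v) ≡ (z ==ᵛ fold² w)
      at z v≡w = cong (λ v → z ==ᵛ fold² v) v≡w
      west : (x , suc y) ≡ corner i k
      west = cong (x ,_) (cong (_+ i) (sym (∸-suc k<b)))
      north : (suc x , suc (suc y)) ≡ corner (suc i) k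
      north = sym (cong₂ _,_ (cong (_+ k) (+-suc a i))
                             (trans (+-suc (b ∸ k) i) (cong (λ t → suc (t + i)) (∸-suc k<b))))
      south : (suc x , y) ≡ corner i (suc k)
      south = sym (cong (_, y) (+-suc (a + i) k))
      east : (suc (suc x) , suc y) ≡ corner (suc i) (suc k)
      east = sym (cong₂ _,_ (trans (cong (_+ suc k) (+-suc a i)) (cong suc (+-suc (a + i) k)))
                            (+-suc (b ∸ suc k) i))

    corners : ∀ z → InRange z → (g 0 0 z xor g 0 b z) xor (g p 0 z xor g p b z) ≡ (z ==ᵛ (a , b))
    corners z r = begin
      (g 0 0 z xor g 0 b z) xor (g p 0 z xor g p b z)
        ≡⟨ cong₂ (λ s t → (g 0 0 z xor s) xor t) (vanishʸ (a + 0 + b) ((b ∸ b) + 0) z bottom r)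
                                                  (cong₂ _xor_ (vanishˣ (a + p + 0) (b + p) z right r)
                                                                (vanishʸ (a + p + b) ((b ∸ b) + p) z top r)) ⟩
      (g 0 0 z xor false) xor false
        ≡⟨ trans (xor-identityʳ _) (xor-identityʳ _) ⟩
      g 0 0 z
        ≡⟨ cong (z ==ᵛ_) origin ⟩
      (z ==ᵛ (a , b))
        ∎
      where
      open ≡-Reasoning
      origin : fold² (corner 0 0) ≡ (a , b)
      origin = cong₂ _,_ (trans (cong Fm.fold (trans (+-identityʳ (a + 0)) (+-identityʳ a))) (Fm.fold-small a a≤m))
                         (trans (cong Fn.fold (+-identityʳ b)) (Fn.fold-small b b≤n))
      bottom : Fn.Boundary (Fn.fold ((b ∸ b) + 0))
      bottom = inj₁ (cong Fn.fold (trans (+-identityʳ (b ∸ b)) (n∸n≡0 b)))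
      right : Fm.Boundary (Fm.fold (a + p + 0))
      right = Fm.fold-boundary (subst (suc m ∣_) (sym (+-identityʳ (a + p))) m+1∣a+p)
      top : Fn.Boundary (Fn.fold ((b ∸ b) + p))
      top = Fn.fold-boundary (subst (suc n ∣_) (cong (_+ p) (sym (n∸n≡0 b))) n+1∣p)

  realizable⇒NPos : ∀ {u} → InRange u → Realizable (_==ᵛ u) → NPos (grid m n) u
  realizable⇒NPos {u} ru (f , f⊆V , odd) = odd⇒NPos grid-undirected u (λ v _ → oddAt v)
    where
    open ParityStrategy (grid m n) colour grid-proper (cartesianProduct vertices vertices) grid⇒∈vertices²
                        neighbours grid⇒neighbour grid⇒neighbours-unique f
    oddAt : ∀ v → oddDegree (grid m n) v ≡ (v ==ᵛ u)
    oddAt v = by-range (inRange m n v) refl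
      where
      by-range : ∀ b → inRange m n v ≡ b → oddDegree (grid m n) v ≡ (v ==ᵛ u)
      by-range true rv = trans (xorSum-cong (neighbours v) {λ y → grid m n v y ∧ f y} restrict) (odd v rv)
        where
        restrict : ∀ {y} → y ∈ neighbours v → grid m n v y ∧ f y ≡ f y
        restrict {y} y∈N with f y in fy
        ... | false = ∧-zeroʳ _
        ... | true  = cong (_∧ true) (neighbour⇒grid rv (f⊆V y fy) y∈N)
      by-range false rv =
        trans (xorSum-cong (neighbours v) {λ y → grid m n v y ∧ f y} (λ {y} _ → cong (_∧ f y) (outside⇒isolated {v} y rv)))
              (sym (≢⇒==ᵛ-false {v} {u} λ { refl → contradiction (trans (sym ru) rv) λ () }))

gcd∣⇒∃-complement : ∀ m n a → gcd (suc m) n ∣ a → ∃[ p ] suc m ∣ a + p × n ∣ p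
gcd∣⇒∃-complement m n _ (divides c refl) with Bézout.identity (gcd-GCD (suc m) n)
... | Bézout.+- x y eq = c * (y * n) , divides (c * x) sum≡ , divides (c * y) (sym (*-assoc c y n))
  where
  open ≡-Reasoning
  d = gcd (suc m) n
  sum≡ : c * d + c * (y * n) ≡ c * x * suc m
  sum≡ = begin
    c * d + c * (y * n)  ≡⟨ *-distribˡ-+ c d (y * n) ⟨
    c * (d + y * n)      ≡⟨ cong (c *_) eq ⟩
    c * (x * suc m)      ≡⟨ *-assoc c x (suc m) ⟨
    c * x * suc m        ∎
-- From d + x(m+1) = y n and a = c d: a + m c y n = (m+1)(a + m c x).
... | Bézout.-+ x y eq = m * (c * (y * n)) , divides (c * d + m * (c * x)) sum≡ , divides (m * (c * y)) (reassoc m c y n)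
  where
  open ≡-Reasoning
  d = gcd (suc m) n
  reassoc : ∀ m c y n → m * (c * (y * n)) ≡ m * (c * y) * n
  reassoc = solve-∀
  expand : ∀ c d m x → c * d + m * (c * (d + x * suc m)) ≡ (c * d + m * (c * x)) * suc m
  expand = solve-∀
  sum≡ : c * d + m * (c * (y * n)) ≡ (c * d + m * (c * x)) * suc m
  sum≡ = begin
    c * d + m * (c * (y * n))          ≡⟨ cong (λ t → c * d + m * (c * t)) eq ⟨
    c * d + m * (c * (d + x * suc m))  ≡⟨ expand c d m x ⟩
    (c * d + m * (c * x)) * suc m      ∎

gcd∣⇒NPos : ∀ m n a b → 1 ≤ a → a ≤ m → 1 ≤ b → b ≤ n → gcd (suc m) (suc n) ∣ a → NPos (grid m n) (a , b)
gcd∣⇒NPos m n a b 1≤a a≤m 1≤b b≤n d∣a with p , m+1∣a+p , n+1∣p ← gcd∣⇒∃-complement m (suc n) a d∣a =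
  realizable⇒NPos (bounds⇒inRange 1≤a a≤m 1≤b b≤n) (realizable-point a≤m b≤n m+1∣a+p n+1∣p)
  where
  open Grid m n
  open Realizability m n

-- The hypotheses 1 ≤ m and 1 ≤ n are implied by the bounds on a and b.
theorem2p4 : (m n : ℕ) → 1 ≤ m → 1 ≤ n → (a b : ℕ) → 1 ≤ a → a ≤ m → 1 ≤ b → b ≤ n →
    (gcd (m + 1) (n + 1) ∣ a ⊎ gcd (m + 1) (n + 1) ∣ b) →
    NPos (grid m n) (a , b)
theorem2p4 m n _ _ a b 1≤a a≤m 1≤b b≤n d∣a⊎d∣b
  with subst (λ d → d ∣ a ⊎ d ∣ b) (cong₂ gcd (+-comm m 1) (+-comm n 1)) d∣a⊎d∣b
... | inj₁ d∣a = gcd∣⇒NPos m n a b 1≤a a≤m 1≤b b≤n d∣a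
... | inj₂ d∣b = NPos-transpose (grid-transposed m n)
                   (gcd∣⇒NPos n m b a 1≤b b≤n 1≤a a≤m (subst (_∣ b) (gcd-comm (suc m) (suc n)) d∣b))
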